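{- Let $q$ be a prime power, $G_4=UU_4(\mathbb{F}_q)$, and $N_2=\{A=(a_{ij})\in G_4\mid a_{23}=0,\ a_{12}a_{34}\neq 0\}$. Define on $N_2$ the equivalence relation $y\,R\,z$ iff $C_{G_4}(y)=C_{G_4}(z)$. Then the set \[X_{N_2}=\{A\in G_4\mid a_{12}=1,\ a_{14}=0,\ a_{23}=0,\ a_{13}\in\mathbb{F}_q,\ a_{24}\in\mathbb{F}_q,\ a_{34}\in\mathbb{F}_q^{*}\}\] contains exactly one element of each $R$-equivalence class of $N_2$, and $|X_{N_2}|=q^2(q-1)$.
   Context: $UU_4(\mathbb{F}_q)$ is the group of $4\times 4$ upper triangular matrices over $\mathbb{F}_q$ with diagonal entries $1$; $C_{G_4}(y)$ is the centralizer of $y$ in $G_4$. -}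

module Defs where

open import Level using (0ℓ)
open import Data.Nat as ℕ using (ℕ)
open import Data.Nat.Primality using (Prime)
open import Data.Fin using (Fin; zero; suc)
open import Data.Vec using (Vec; lookup; tabulate)
open import Data.Product using (Σ; ∃; _×_; _,_)
open import Relation.Nullary using (¬_)
open import Relation.Binary.PropositionalEquality using (_≡_)
open import Function.Bundles using (_↔_; _⇔_)
import Algebra.Structures as AS

IsPrimePower : ℕ → Set
IsPrimePower q = Σ ℕ λ p → Σ ℕ λ k → Prime p × 1 ℕ.≤ k × q ≡ p ℕ.^ k

record FiniteField (q : ℕ) : Set₁ where
  infixl 6 _+_
  infixl 7 _*_
  field
    Carrier : Set
    _+_ _*_ : Carrier → Carrier → Carrier
    -_ : Carrier → Carrier
    0# 1# : Carrier
    isCommutativeRing : AS.IsCommutativeRing {A = Carrier} _≡_ _+_ _*_ -_ 0# 1#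
    0≢1 : ¬ (0# ≡ 1#)
    inverse : ∀ x → ¬ (x ≡ 0#) → ∃ λ y → x * y ≡ 1#
    enumeration : Carrier ↔ Fin q

module UU4 {q : ℕ} (F : FiniteField q) where
  open FiniteField F

  -- 4×4 matrices over F (rows of entries); indices are 0-based,
  -- so the paper's a_{ij} is  entry A (i-1) (j-1).
  Mat4 : Set
  Mat4 = Vec (Vec Carrier 4) 4

  entry : Mat4 → Fin 4 → Fin 4 → Carrier
  entry A i j = lookup (lookup A i) j

  i0 i1 i2 i3 : Fin 4
  i0 = zero
  i1 = suc zero
  i2 = suc (suc zero)
  i3 = suc (suc (suc zero))

  _·_ : Mat4 → Mat4 → Mat4
  A · B = tabulate λ i → tabulate λ j →
    entry A i i0 * entry B i0 j + entry A i i1 * entry B i1 j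
    + entry A i i2 * entry B i2 j + entry A i i3 * entry B i3 j

  InG4 : Mat4 → Set
  InG4 A =
    (entry A i0 i0 ≡ 1#) × (entry A i1 i1 ≡ 1#) × (entry A i2 i2 ≡ 1#) × (entry A i3 i3 ≡ 1#)
    × (entry A i1 i0 ≡ 0#) × (entry A i2 i0 ≡ 0#) × (entry A i3 i0 ≡ 0#)
    × (entry A i2 i1 ≡ 0#) × (entry A i3 i1 ≡ 0#) × (entry A i3 i2 ≡ 0#)

  InCentralizer : Mat4 → Mat4 → Set
  InCentralizer y g = InG4 g × (g · y ≡ y · g)

  R : Mat4 → Mat4 → Set
  R y z = ∀ g → (InCentralizer y g ⇔ InCentralizer z g)

  InN2 : Mat4 → Set
  InN2 A = InG4 A × (entry A i1 i2 ≡ 0#) × ¬ (entry A i0 i1 * entry A i2 i3 ≡ 0#)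

  InX : Mat4 → Set
  InX A = InG4 A × (entry A i0 i1 ≡ 1#) × (entry A i0 i3 ≡ 0#)
          × (entry A i1 i2 ≡ 0#) × ¬ (entry A i2 i3 ≡ 0#)

module Submission where

-- Every element of G4 is the unitriangular matrix with six coordinates
-- x12 … x34 above the diagonal.  Comparing the products g·y and y·g entry
-- by entry (by ring normalisation) shows that they commute iff three
-- polynomial identities hold.  For y ∈ N2 (y23 = 0, y12 invertible) this
-- says: g23 = 0 and the linear equation
--     g12 y24 + g13 y34 = y12 g24 + y13 g34
-- holds.  That equation is unchanged when (y12, y13, y24, y34) is scaled by
-- a unit, so rescaling by y12⁻¹ gives an element of X_{N2} with the same
-- centralizer; conversely for normalised coordinates (y12 = 1) three test
-- matrices recover y13, y24, y34, which gives uniqueness.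

open import Defs
open import Data.Nat using (ℕ; zero; suc; _∸_; _^_)
import Data.Nat as ℕ
import Data.Nat.Properties as ℕ
open import Data.Fin using (Fin; zero; suc; #_; punchIn; punchOut)
open import Data.Fin.Properties using (punchIn-injective; punchInᵢ≢i; punchIn-punchOut)
open import Data.Vec using (Vec; []; _∷_; tabulate)
open import Data.Vec.Properties using (tabulate-cong)
open import Data.List as List using (List; []; _∷_; length; map; cartesianProduct)
open import Data.List.Properties using (length-tabulate; length-map; length-++)
open import Data.List.Membership.Propositional using (_∈_)
open import Data.List.Membership.Propositional.Properties
  using (∈-tabulate⁺; ∈-tabulate⁻; ∈-map⁺; ∈-map⁻; ∈-cartesianProduct⁺; ∈-cartesianProduct⁻)
open import Data.List.Relation.Unary.Unique.Propositional using (Unique)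
import Data.List.Relation.Unary.Unique.Propositional.Properties as Unique
open import Data.Product using (Σ; ∃; _×_; _,_; proj₁; proj₂)
open import Data.Product.Function.NonDependent.Propositional using (_×-⇔_)
open import Data.Unit using (tt)
open import Algebra.Bundles using (CommutativeRing)
open import Relation.Binary.PropositionalEquality
open import Relation.Nullary using (¬_)
open import Relation.Unary using (U; _⟨×⟩_)
open import Function using (_∘_)
open import Function.Bundles using (_⇔_; mk⇔; _↔_; Inverse; Injection; Equivalence)
open import Function.Properties.Inverse using (↔⇒↣)
open import Function.Construct.Symmetry using (↔-sym)
import Function.Properties.Equivalence as ⇔

open Equivalence using (to; from)

record Listing {A : Set} (P : A → Set) (n : ℕ) : Set where
  field
    elems    : List A
    unique   : Unique elems
    complete : ∀ a → a ∈ elems ⇔ P a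
    size     : length elems ≡ n

listing-all : ∀ {A : Set} {n} → A ↔ Fin n → Listing {A} U n
listing-all e = record
  { elems    = List.tabulate element
  ; unique   = Unique.tabulate⁺ (Injection.injective (↔⇒↣ (↔-sym e)))
  ; complete = λ a → mk⇔ (λ _ → tt)
      (λ _ → subst (_∈ List.tabulate element) (Inverse.strictlyInverseʳ e a) (∈-tabulate⁺ (index a)))
  ; size     = length-tabulate element
  }
  where open Inverse e using () renaming (to to index; from to element)

listing-except : ∀ {A : Set} {n} → A ↔ Fin n → (a : A) → Listing (λ x → ¬ x ≡ a) (n ∸ 1)
listing-except {n = zero} e a with Inverse.to e a
... | ()
listing-except {A} {n = suc m} e a = record
  { elems    = List.tabulate others
  ; unique   = Unique.tabulate⁺ (λ {i} {j} eq → punchIn-injective k i j (Injection.injective (↔⇒↣ (↔-sym e)) eq))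
  ; complete = λ x → mk⇔ (member⇒ x) (⇒member x)
  ; size     = length-tabulate others
  }
  where
  open Inverse e using () renaming (to to index; from to element)
  k : Fin (suc m)
  k = index a
  others : Fin m → A
  others i = element (punchIn k i)
  member⇒ : ∀ x → x ∈ List.tabulate others → ¬ x ≡ a
  member⇒ x x∈ x≡a with ∈-tabulate⁻ x∈
  ... | i , refl = punchInᵢ≢i k i (trans (sym (Inverse.strictlyInverseˡ e (punchIn k i))) (cong index x≡a))
  ⇒member : ∀ x → ¬ x ≡ a → x ∈ List.tabulate others
  ⇒member x x≢a = subst (_∈ List.tabulate others)
    (trans (cong element (punchIn-punchOut k≢x)) (Inverse.strictlyInverseʳ e x))
    (∈-tabulate⁺ (punchOut k≢x))
    where
    k≢x : ¬ k ≡ index x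
    k≢x eq = x≢a (trans (sym (Inverse.strictlyInverseʳ e x))
                        (trans (cong element (sym eq)) (Inverse.strictlyInverseʳ e a)))

length-cartesianProduct : ∀ {A B : Set} (xs : List A) (ys : List B) →
  length (cartesianProduct xs ys) ≡ length xs ℕ.* length ys
length-cartesianProduct []       ys = refl
length-cartesianProduct (x ∷ xs) ys =
  trans (length-++ (map (x ,_) ys))
        (cong₂ ℕ._+_ (length-map (x ,_) ys) (length-cartesianProduct xs ys))

listing-× : ∀ {A B : Set} {P : A → Set} {Q : B → Set} {m k} →
  Listing P m → Listing Q k → Listing (P ⟨×⟩ Q) (m ℕ.* k)
listing-× {P = P} {Q} lp lq = record
  { elems    = cartesianProduct (elems lp) (elems lq)
  ; unique   = Unique.cartesianProduct⁺ (unique lp) (unique lq)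
  ; complete = λ (a , b) → mk⇔
      (λ ab∈ → let a∈ , b∈ = ∈-cartesianProduct⁻ (elems lp) (elems lq) ab∈
               in to (complete lp a) a∈ , to (complete lq b) b∈)
      (λ (pa , qb) → ∈-cartesianProduct⁺ (from (complete lp a) pa) (from (complete lq b) qb))
  ; size     = trans (length-cartesianProduct (elems lp) (elems lq)) (cong₂ ℕ._*_ (size lp) (size lq))
  }
  where open Listing

listing-image : ∀ {A B : Set} {P : B → Set} {Q : A → Set} {n} (f : A → B) →
  (∀ {a a′} → f a ≡ f a′ → a ≡ a′) → (∀ b → P b ⇔ ∃ λ a → Q a × f a ≡ b) →
  Listing Q n → Listing P n
listing-image {P = P} f f-injective image lq = record
  { elems    = map f (elems lq)
  ; unique   = Unique.map⁺ f-injective (unique lq)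
  ; complete = λ b → mk⇔
      (λ b∈ → let a , a∈ , b≡fa = ∈-map⁻ f b∈
              in from (image b) (a , to (complete lq a) a∈ , sym b≡fa))
      (λ pb → let a , qa , fa≡b = to (image b) pb
              in subst (_∈ map f (elems lq)) fa≡b (∈-map⁺ f (from (complete lq a) qa)))
  ; size     = trans (length-map f (elems lq)) (size lq)
  }
  where open Listing

module Centralizers {q : ℕ} (F : FiniteField q) where
  open FiniteField F
  open UU4 F

  -- F as a commutative ring, to use the library's ring lemmas and solver.
  commutativeRing : CommutativeRing _ _
  commutativeRing = record { isCommutativeRing = isCommutativeRing }

  open CommutativeRing commutativeRing
    using (*-comm; *-assoc; *-identityˡ; zeroˡ; zeroʳ; -‿inverseˡ; +-group)
  open import Algebra.Properties.Group +-group using (∙-cancelˡ)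
  open import Algebra.Solver.Ring.NaturalCoefficients.Default
    (CommutativeRing.commutativeSemiring commutativeRing)

  +-cancel⇔ : ∀ {u v s l r} → u ≡ s + l → v ≡ s + r → (u ≡ v ⇔ l ≡ r)
  +-cancel⇔ {s = s} u≡ v≡ = mk⇔
    (λ u≡v → ∙-cancelˡ s _ _ (trans (sym u≡) (trans u≡v v≡)))
    (λ l≡r → trans u≡ (trans (cong (s +_) l≡r) (sym v≡)))

  unit-cancel : ∀ {a b u v} → b * a ≡ 1# → a * u ≡ a * v → u ≡ v
  unit-cancel {a} {b} {u} {v} ba≡1 eq = begin
    u             ≡⟨ sym (*-identityˡ u) ⟩
    1# * u        ≡⟨ cong (_* u) (sym ba≡1) ⟩
    b * a * u     ≡⟨ *-assoc b a u ⟩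
    b * (a * u)   ≡⟨ cong (b *_) eq ⟩
    b * (a * v)   ≡⟨ sym (*-assoc b a v) ⟩
    b * a * v     ≡⟨ cong (_* v) ba≡1 ⟩
    1# * v        ≡⟨ *-identityˡ v ⟩
    v             ∎
    where open ≡-Reasoning

  *-by-zeroˡ : ∀ {a b} → a ≡ 0# → a * b ≡ 0#
  *-by-zeroˡ {b = b} refl = zeroˡ b

  *-by-zeroʳ : ∀ {a b} → b ≡ 0# → a * b ≡ 0#
  *-by-zeroʳ {a} refl = zeroʳ a

  record Coords (A : Set) : Set where
    constructor coords
    field x12 x13 x14 x23 x24 x34 : A
  open Coords

  -- The unitriangular array with given coordinates, over any type with
  -- chosen "zero" and "one"; used both for matrices and for symbolic ones.
  layout : {A : Set} → A → A → Coords A → Fin 4 → Fin 4 → A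
  layout o e c zero                   zero                   = e
  layout o e c zero                   (suc zero)             = x12 c
  layout o e c zero                   (suc (suc zero))       = x13 c
  layout o e c zero                   (suc (suc (suc zero))) = x14 c
  layout o e c (suc zero)             (suc zero)             = e
  layout o e c (suc zero)             (suc (suc zero))       = x23 c
  layout o e c (suc zero)             (suc (suc (suc zero))) = x24 c
  layout o e c (suc (suc zero))       (suc (suc zero))       = e
  layout o e c (suc (suc zero))       (suc (suc (suc zero))) = x34 c
  layout o e c (suc (suc (suc zero))) (suc (suc (suc zero))) = e
  layout o e c _                      _                      = o

  unitri : Coords Carrier → Mat4
  unitri c = tabulate λ i → tabulate λ j → layout 0# 1# c i j

  unitri-InG4 : ∀ c → InG4 (unitri c)
  unitri-InG4 c = refl , refl , refl , refl , refl , refl , refl , refl , refl , refl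

  InG4⇒unitri : ∀ A → InG4 A → ∃ λ c → A ≡ unitri c
  InG4⇒unitri ((_ ∷ a12 ∷ a13 ∷ a14 ∷ []) ∷ (_ ∷ _ ∷ a23 ∷ a24 ∷ []) ∷
               (_ ∷ _ ∷ _ ∷ a34 ∷ []) ∷ (_ ∷ _ ∷ _ ∷ _ ∷ []) ∷ [])
              (refl , refl , refl , refl , refl , refl , refl , refl , refl , refl) =
    coords a12 a13 a14 a23 a24 a34 , refl

  unitri-injective : ∀ {c c′} → unitri c ≡ unitri c′ → c ≡ c′
  unitri-injective {coords _ _ _ _ _ _} {coords _ _ _ _ _ _} eq
    with cong (λ M → entry M i0 i1) eq | cong (λ M → entry M i0 i2) eq | cong (λ M → entry M i0 i3) eq
       | cong (λ M → entry M i1 i2) eq | cong (λ M → entry M i1 i3) eq | cong (λ M → entry M i2 i3) eq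
  ... | refl | refl | refl | refl | refl | refl = refl

  Commute : Coords Carrier → Coords Carrier → Set
  Commute g y = (x12 g * x23 y ≡ x12 y * x23 g)
              × (x23 g * x34 y ≡ x23 y * x34 g)
              × (x12 g * x24 y + x13 g * x34 y ≡ x12 y * x24 g + x13 y * x34 g)

  -- Symbolic computation of the entries of g·y and y·g: the coordinates
  -- become twelve polynomial variables, evaluated at ρ.
  module Products (g y : Coords Carrier) where
    ρ : Vec Carrier 12
    ρ = x12 g ∷ x13 g ∷ x14 g ∷ x23 g ∷ x24 g ∷ x34 g ∷
        x12 y ∷ x13 y ∷ x14 y ∷ x23 y ∷ x24 y ∷ x34 y ∷ []

    gᴾ yᴾ : Coords (Polynomial 12)
    gᴾ = coords (var (# 0)) (var (# 1)) (var (# 2)) (var (# 3)) (var (# 4)) (var (# 5))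
    yᴾ = coords (var (# 6)) (var (# 7)) (var (# 8)) (var (# 9)) (var (# 10)) (var (# 11))

    Gᴾ Yᴾ : Fin 4 → Fin 4 → Polynomial 12
    Gᴾ = layout (con 0) (con 1) gᴾ
    Yᴾ = layout (con 0) (con 1) yᴾ

    _·ᴾ_ : (Fin 4 → Fin 4 → Polynomial 12) → (Fin 4 → Fin 4 → Polynomial 12) → Fin 4 → Fin 4 → Polynomial 12
    (A ·ᴾ B) i j = A i i0 :* B i0 j :+ A i i1 :* B i1 j :+ A i i2 :* B i2 j :+ A i i3 :* B i3 j

    GYᴾ YGᴾ : Fin 4 → Fin 4 → Polynomial 12
    GYᴾ = Gᴾ ·ᴾ Yᴾ
    YGᴾ = Yᴾ ·ᴾ Gᴾ

    -- At (1,3), (2,4) and (1,4) the products are S + L and S + R with a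
    -- common part S; there they agree iff L = R.
    entry13⇔ : (entry (unitri g · unitri y) i0 i2 ≡ entry (unitri y · unitri g) i0 i2)
             ⇔ (x12 g * x23 y ≡ x12 y * x23 g)
    entry13⇔ = +-cancel⇔
      (prove ρ (GYᴾ i0 i2) (x13 gᴾ :+ x13 yᴾ :+ x12 gᴾ :* x23 yᴾ) refl)
      (prove ρ (YGᴾ i0 i2) (x13 gᴾ :+ x13 yᴾ :+ x12 yᴾ :* x23 gᴾ) refl)

    entry24⇔ : (entry (unitri g · unitri y) i1 i3 ≡ entry (unitri y · unitri g) i1 i3)
             ⇔ (x23 g * x34 y ≡ x23 y * x34 g)
    entry24⇔ = +-cancel⇔
      (prove ρ (GYᴾ i1 i3) (x24 gᴾ :+ x24 yᴾ :+ x23 gᴾ :* x34 yᴾ) refl)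
      (prove ρ (YGᴾ i1 i3) (x24 gᴾ :+ x24 yᴾ :+ x23 yᴾ :* x34 gᴾ) refl)

    entry14⇔ : (entry (unitri g · unitri y) i0 i3 ≡ entry (unitri y · unitri g) i0 i3)
             ⇔ (x12 g * x24 y + x13 g * x34 y ≡ x12 y * x24 g + x13 y * x34 g)
    entry14⇔ = +-cancel⇔
      (prove ρ (GYᴾ i0 i3) (x14 gᴾ :+ x14 yᴾ :+ (x12 gᴾ :* x24 yᴾ :+ x13 gᴾ :* x34 yᴾ)) refl)
      (prove ρ (YGᴾ i0 i3) (x14 gᴾ :+ x14 yᴾ :+ (x12 yᴾ :* x24 gᴾ :+ x13 yᴾ :* x34 gᴾ)) refl)

  -- Commutation criterion: only the entries (1,3), (2,4), (1,4) can differ.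
  commute⇔ : ∀ g y → (unitri g · unitri y ≡ unitri y · unitri g) ⇔ Commute g y
  commute⇔ g y = mk⇔
    (λ gy≡yg → to entry13⇔ (at i0 i2 gy≡yg) , to entry24⇔ (at i1 i3 gy≡yg) , to entry14⇔ (at i0 i3 gy≡yg))
    (λ c → tabulate-cong λ i → tabulate-cong λ j → entries c i j)
    where
    open Products g y
    at : ∀ i j {M N : Mat4} → M ≡ N → entry M i j ≡ entry N i j
    at i j = cong (λ M → entry M i j)
    entries : Commute g y → ∀ i j → entry (unitri g · unitri y) i j ≡ entry (unitri y · unitri g) i j
    entries _                zero                   zero                   = prove ρ (GYᴾ i0 i0) (YGᴾ i0 i0) refl
    entries _                zero                   (suc zero)             = prove ρ (GYᴾ i0 i1) (YGᴾ i0 i1) refl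
    entries (c13 , _ , _)    zero                   (suc (suc zero))       = from entry13⇔ c13
    entries (_ , _ , c14)    zero                   (suc (suc (suc zero))) = from entry14⇔ c14
    entries _                (suc zero)             zero                   = prove ρ (GYᴾ i1 i0) (YGᴾ i1 i0) refl
    entries _                (suc zero)             (suc zero)             = prove ρ (GYᴾ i1 i1) (YGᴾ i1 i1) refl
    entries _                (suc zero)             (suc (suc zero))       = prove ρ (GYᴾ i1 i2) (YGᴾ i1 i2) refl
    entries (_ , c24 , _)    (suc zero)             (suc (suc (suc zero))) = from entry24⇔ c24
    entries _                (suc (suc zero))       zero                   = prove ρ (GYᴾ i2 i0) (YGᴾ i2 i0) refl
    entries _                (suc (suc zero))       (suc zero)             = prove ρ (GYᴾ i2 i1) (YGᴾ i2 i1) refl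
    entries _                (suc (suc zero))       (suc (suc zero))       = prove ρ (GYᴾ i2 i2) (YGᴾ i2 i2) refl
    entries _                (suc (suc zero))       (suc (suc (suc zero))) = prove ρ (GYᴾ i2 i3) (YGᴾ i2 i3) refl
    entries _                (suc (suc (suc zero))) zero                   = prove ρ (GYᴾ i3 i0) (YGᴾ i3 i0) refl
    entries _                (suc (suc (suc zero))) (suc zero)             = prove ρ (GYᴾ i3 i1) (YGᴾ i3 i1) refl
    entries _                (suc (suc (suc zero))) (suc (suc zero))       = prove ρ (GYᴾ i3 i2) (YGᴾ i3 i2) refl
    entries _                (suc (suc (suc zero))) (suc (suc (suc zero))) = prove ρ (GYᴾ i3 i3) (YGᴾ i3 i3) refl

  centralizer⇔ : ∀ y g → InCentralizer (unitri y) g ⇔ (∃ λ c → g ≡ unitri c × Commute c y)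
  centralizer⇔ y g = mk⇔ described (λ (c , g≡ , cy) → subst (InCentralizer (unitri y)) (sym g≡) (unitri-InG4 c , from (commute⇔ c y) cy))
    where
    described : InCentralizer (unitri y) g → ∃ λ c → g ≡ unitri c × Commute c y
    described (g∈G4 , gy≡yg) with InG4⇒unitri g g∈G4
    ... | c , refl = c , refl , to (commute⇔ c y) gy≡yg

  same-centralizer : ∀ y y′ → (∀ c → Commute c y ⇔ Commute c y′) → R (unitri y) (unitri y′)
  same-centralizer y y′ same g = mk⇔ (transfer y y′ (to ∘ same)) (transfer y′ y (from ∘ same))
    where
    transfer : ∀ z z′ → (∀ c → Commute c z → Commute c z′) → InCentralizer (unitri z) g → InCentralizer (unitri z′) g
    transfer z z′ z⇒z′ g∈C = let c , g≡ , cz = to (centralizer⇔ z g) g∈C in from (centralizer⇔ z′ g) (c , g≡ , z⇒z′ c cz)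

  centralizer-⊆ : ∀ y y′ → R (unitri y) (unitri y′) → ∀ c → Commute c y → Commute c y′
  centralizer-⊆ y y′ r c cy =
    let c′ , c≡c′ , c′y′ = to (centralizer⇔ y′ (unitri c)) (to (r (unitri c)) (from (centralizer⇔ y (unitri c)) (c , refl , cy)))
    in subst (λ d → Commute d y′) (sym (unitri-injective c≡c′)) c′y′

  -- The linear equation that, besides g23 = 0, describes the centralizer
  -- of an element of N2.
  Balanced : Coords Carrier → Coords Carrier → Set
  Balanced g y = x12 g * x24 y + x13 g * x34 y ≡ x12 y * x24 g + x13 y * x34 g

  commute-N2⇔ : ∀ g y → x23 y ≡ 0# → ¬ x12 y ≡ 0# → Commute g y ⇔ (x23 g ≡ 0# × Balanced g y)
  commute-N2⇔ g y y23≡0 y12≢0 = mk⇔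
    (λ (c13 , _ , c14) → g23≡0 c13 , c14)
    (λ (g23≡0 , balanced) → trans (*-by-zeroʳ y23≡0) (sym (*-by-zeroʳ g23≡0))
                          , trans (*-by-zeroˡ g23≡0) (sym (*-by-zeroˡ y23≡0))
                          , balanced)
    where
    -- y12 g23 = g12 y23 = 0 forces g23 = 0 because y12 is invertible.
    g23≡0 : x12 g * x23 y ≡ x12 y * x23 g → x23 g ≡ 0#
    g23≡0 c13 = let ι , y12ι≡1 = inverse (x12 y) y12≢0 in
      unit-cancel (trans (*-comm ι (x12 y)) y12ι≡1)
        (trans (sym c13) (trans (*-by-zeroʳ y23≡0) (sym (zeroʳ (x12 y)))))

  rescale : Carrier → Coords Carrier → Coords Carrier
  rescale k y = coords (k * x12 y) (k * x13 y) 0# 0# (k * x24 y) (k * x34 y)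

  -- Balanced g y is homogeneous in y, so rescaling by a unit preserves it.
  Balanced-rescale : ∀ {k k⁻¹} → k⁻¹ * k ≡ 1# → ∀ g y → Balanced g y ⇔ Balanced g (rescale k y)
  Balanced-rescale {k} k⁻¹k≡1 g y = mk⇔
    (λ balanced → trans lhs (trans (cong (k *_) balanced) (sym rhs)))
    (λ balanced′ → unit-cancel k⁻¹k≡1 (trans (sym lhs) (trans balanced′ rhs)))
    where
    lhs : x12 g * (k * x24 y) + x13 g * (k * x34 y) ≡ k * (x12 g * x24 y + x13 g * x34 y)
    lhs = solve 5 (λ k a b c d → a :* (k :* b) :+ c :* (k :* d) := k :* (a :* b :+ c :* d))
                refl k (x12 g) (x24 y) (x13 g) (x34 y)
    rhs : k * x12 y * x24 g + k * x13 y * x34 g ≡ k * (x12 y * x24 g + x13 y * x34 g)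
    rhs = solve 5 (λ k a b c d → k :* a :* b :+ k :* c :* d := k :* (a :* b :+ c :* d))
                refl k (x12 y) (x24 g) (x13 y) (x34 g)

  -- Each y ∈ N2 has the centralizer of its rescaling by y12⁻¹, which lies in X.
  N2-representative : ∀ y → InN2 y → Σ Mat4 λ x → InX x × R x y
  N2-representative y (y∈G4 , y23≡0 , y12y34≢0) with InG4⇒unitri y y∈G4
  ... | c , refl = unitri x , x∈X , same-centralizer x c same
    where
    y12≢0 : ¬ x12 c ≡ 0#
    y12≢0 y12≡0 = y12y34≢0 (*-by-zeroˡ y12≡0)
    y34≢0 : ¬ x34 c ≡ 0#
    y34≢0 y34≡0 = y12y34≢0 (*-by-zeroʳ y34≡0)
    ι : Carrier
    ι = proj₁ (inverse (x12 c) y12≢0)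
    y12ι≡1 : x12 c * ι ≡ 1#
    y12ι≡1 = proj₂ (inverse (x12 c) y12≢0)
    ιy12≡1 : ι * x12 c ≡ 1#
    ιy12≡1 = trans (*-comm ι (x12 c)) y12ι≡1
    x : Coords Carrier
    x = rescale ι c
    x∈X : InX (unitri x)
    x∈X = unitri-InG4 x , ιy12≡1 , refl , refl
        , λ ιy34≡0 → y34≢0 (unit-cancel y12ι≡1 (trans ιy34≡0 (sym (zeroʳ ι))))
    same : ∀ g → Commute g x ⇔ Commute g c
    same g = ⇔.trans (commute-N2⇔ g x refl (λ ιy12≡0 → 0≢1 (trans (sym ιy12≡0) ιy12≡1)))
            (⇔.trans (⇔.refl ×-⇔ ⇔.sym (Balanced-rescale y12ι≡1 g c))
                     (⇔.sym (commute-N2⇔ g c y23≡0 y12≢0)))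

  -- Elements of X are unitri (normal (b , d , c)) with c ≠ 0.
  normal : Carrier × Carrier × Carrier → Coords Carrier
  normal (b , d , c) = coords 1# b 0# 0# d c

  normal-injective : ∀ {p p′} → normal p ≡ normal p′ → p ≡ p′
  normal-injective {_ , _ , _} {_ , _ , _} eq = cong₂ _,_ (cong x13 eq) (cong₂ _,_ (cong x24 eq) (cong x34 eq))

  Admissible : Carrier × Carrier × Carrier → Set
  Admissible = U ⟨×⟩ U ⟨×⟩ (λ c → ¬ c ≡ 0#)

  InX⇔ : ∀ A → InX A ⇔ (∃ λ p → Admissible p × unitri (normal p) ≡ A)
  InX⇔ A = mk⇔ (parameters A) (λ (p , (_ , _ , c≢0) , eq) → subst InX eq (unitri-InG4 (normal p) , refl , refl , refl , c≢0))
    where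
    parameters : ∀ A → InX A → ∃ λ p → Admissible p × unitri (normal p) ≡ A
    parameters ((_ ∷ _ ∷ b ∷ _ ∷ []) ∷ (_ ∷ _ ∷ _ ∷ d ∷ []) ∷ (_ ∷ _ ∷ _ ∷ c ∷ []) ∷ (_ ∷ _ ∷ _ ∷ _ ∷ []) ∷ [])
      ((refl , refl , refl , refl , refl , refl , refl , refl , refl , refl) , refl , refl , refl , c≢0) =
      (b , d , c) , (tt , tt , c≢0) , refl

  -- x12 = 1 makes x12 x34 ≠ 0 follow from x34 ≠ 0.
  X⊆N2 : ∀ x → InX x → InN2 x
  X⊆N2 x (x∈G4 , x12≡1 , _ , x23≡0 , x34≢0) =
    x∈G4 , x23≡0 , λ x12x34≡0 → x34≢0 (trans (sym (*-identityˡ _)) (trans (cong (_* entry x i2 i3) (sym x12≡1)) x12x34≡0))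

  -- Test matrices in the centralizer of every element of N2 (they have g23 = 0).
  probe : Carrier → Carrier → Carrier → Carrier → Coords Carrier
  probe g12 g13 g24 g34 = coords g12 g13 0# 0# g24 g34

  -- For normal p = (1, b, 0, 0, d, c) the three probes below lie in the
  -- centralizer exactly when d, c, resp. b equals the chosen value e.
  probe-d⇔ : ∀ p e → Balanced (probe 1# 0# e 0#) (normal p) ⇔ (proj₁ (proj₂ p) ≡ e)
  probe-d⇔ (b , d , c) e = subst₂ (λ l r → (l ≡ r) ⇔ (d ≡ e))
    (solve 2 (λ d c → d := con 1 :* d :+ con 0 :* c) refl d c)
    (solve 2 (λ b e → e := con 1 :* e :+ b :* con 0) refl b e) ⇔.refl

  probe-c⇔ : ∀ p e → Balanced (probe 0# 1# e 0#) (normal p) ⇔ (proj₂ (proj₂ p) ≡ e)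
  probe-c⇔ (b , d , c) e = subst₂ (λ l r → (l ≡ r) ⇔ (c ≡ e))
    (solve 2 (λ d c → c := con 0 :* d :+ con 1 :* c) refl d c)
    (solve 2 (λ b e → e := con 1 :* e :+ b :* con 0) refl b e) ⇔.refl

  probe-b⇔ : ∀ p e → Balanced (probe 0# 0# (- e) 1#) (normal p) ⇔ (proj₁ p ≡ e)
  probe-b⇔ (b , d , c) e = subst₂ (λ l r → (l ≡ r) ⇔ (b ≡ e))
    (solve 2 (λ d c → con 0 := con 0 :* d :+ con 0 :* c) refl d c)
    (solve 2 (λ n b → n :+ b := con 1 :* n :+ b :* con 1) refl (- e) b)
    (⇔.trans (mk⇔ sym sym) (+-cancel⇔ refl (sym (-‿inverseˡ e))))

  normal-determined : ∀ p p′ → (∀ g → Commute g (normal p) → Commute g (normal p′)) → p ≡ p′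
  normal-determined p p′ p⇒p′ =
    sym (cong₂ _,_ (read (λ e → probe 0# 0# (- e) 1#) proj₁ probe-b⇔ (λ _ → refl))
                   (cong₂ _,_ (read (λ e → probe 1# 0# e 0#) (proj₁ ∘ proj₂) probe-d⇔ (λ _ → refl))
                              (read (λ e → probe 0# 1# e 0#) (proj₂ ∘ proj₂) probe-c⇔ (λ _ → refl))))
    where
    1≢0 : ¬ 1# ≡ 0#
    1≢0 = 0≢1 ∘ sym
    balanced⇒ : ∀ g → x23 g ≡ 0# → Balanced g (normal p) → Balanced g (normal p′)
    balanced⇒ g g23≡0 balanced = proj₂ (to (commute-N2⇔ g (normal p′) refl 1≢0)
      (p⇒p′ g (from (commute-N2⇔ g (normal p) refl 1≢0) (g23≡0 , balanced))))
    read : (probeᵉ : Carrier → Coords Carrier) (component : Carrier × Carrier × Carrier → Carrier) →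
           (∀ p e → Balanced (probeᵉ e) (normal p) ⇔ (component p ≡ e)) →
           (∀ e → x23 (probeᵉ e) ≡ 0#) → component p′ ≡ component p
    read probeᵉ component probe⇔ g23≡0 =
      to (probe⇔ p′ _) (balanced⇒ (probeᵉ (component p)) (g23≡0 _) (from (probe⇔ p _) refl))

  X-unique : ∀ x x′ → InX x → InX x′ → R x x′ → x ≡ x′
  X-unique x x′ x∈X x′∈X r =
    let p , _ , px≡x = to (InX⇔ x) x∈X
        p′ , _ , p′x≡x′ = to (InX⇔ x′) x′∈X
        r′ = subst₂ R (sym px≡x) (sym p′x≡x′) r
    in subst₂ _≡_ px≡x p′x≡x′
         (cong (unitri ∘ normal) (normal-determined p p′ (centralizer-⊆ (normal p) (normal p′) r′)))

  -- X is listed by its parameters: q choices each for b and d, q - 1 for c.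
  X-listing : Listing InX (q ^ 2 ℕ.* (q ∸ 1))
  X-listing = subst (Listing InX) count
    (listing-image (unitri ∘ normal) (normal-injective ∘ unitri-injective) InX⇔
      (listing-× (listing-all enumeration) (listing-× (listing-all enumeration) (listing-except enumeration 0#))))
    where
    count : q ℕ.* (q ℕ.* (q ∸ 1)) ≡ q ^ 2 ℕ.* (q ∸ 1)
    count = trans (sym (ℕ.*-assoc q q (q ∸ 1))) (cong (λ t → q ℕ.* t ℕ.* (q ∸ 1)) (sym (ℕ.*-identityʳ q)))

-- Natural-number multiplication is opened only here, since inside
-- Centralizers the name _*_ denotes multiplication in F.
open import Data.Nat using (_*_)

lemma4p7 : (q : ℕ) → IsPrimePower q → (F : FiniteField q) →
    let open UU4 F in
    (∀ x → InX x → InN2 x)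
    × (∀ y → InN2 y → Σ Mat4 λ x → InX x × R x y)
    × (∀ x x′ → InX x → InX x′ → R x x′ → x ≡ x′)
    × (Σ (List Mat4) λ xs → Unique xs × (∀ A → (A ∈ xs ⇔ InX A)) × (length xs ≡ q ^ 2 * (q ∸ 1)))
lemma4p7 q _ F = X⊆N2 , N2-representative , X-unique , elems , unique , complete , size
  where
  open Centralizers F
  open Listing X-listing
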